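{- For any FRACTRAN program $Q$ and any $f:(\mathbb N\to\mathbb N)\to\mathbb N$, one can compute a map which, given a Diophantine witness for $f$, produces a Diophantine witness for the relation $\nu\mapsto\forall y,\ \neg\bigl(Q:f\nu\succ y\bigr)$.
   Context: A FRACTRAN program is a list of pairs $(p,q)\in\mathbb N^2$, written $p/q$. The step relation $Q:x\succ y$ is defined inductively. - $(p/q::Q'):x\succ y$ if $qy=px$. - $(p/q::Q'):x\succ y$ if $q\nmid px$ and $Q':x\succ y$. The empty program has no steps. Diophantine logic formulas are $A,B::= x_i\doteq n\mid x_i\doteq x_j\mid x_i\doteq x_j\dot+x_k\mid x_i\doteq x_j\dot\times x_k\mid A\dot\wedge B\mid A\dot\vee B\mid\dot\exists A$ (De Bruijn indices). For a valuation $\nu:\mathbb N\to\mathbb N$ the semantics is as follows. - Atoms have their obvious meaning. - $\dot\wedge$ and $\dot\vee$ are interpreted as $\wedge$ and $\vee$. - $[\![\dot\exists A]\!]\nu\iff\exists n,\ [\![A]\!](n\cdot\nu)$, with $(n\cdot\nu)(0)=n$ and $(n\cdot\nu)(i+1)=\nu(i)$. A Diophantine witness for a relation $S$ on valuations is a formula $A$ with $[\![A]\!]\nu\leftrightarrow S\,\nu$ for all $\nu$. A Diophantine witness for $f:(\mathbb N\to\mathbb N)\to\mathbb N$ is one for the relation $\nu\mapsto\nu(0)=f(\uparrow\nu)$, where $(\uparrow\nu)(i)=\nu(i+1)$. -}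

module Defs where

open import Data.Nat using (ℕ; zero; suc; _+_; _*_)
open import Data.Nat.Divisibility using (_∣_)
open import Data.Product using (_×_; _,_; Σ; ∃)
open import Data.Sum using (_⊎_)
open import Data.List using (List; []; _∷_)
open import Relation.Binary.PropositionalEquality using (_≡_)
open import Relation.Nullary using (¬_)
open import Function.Bundles using (_⇔_)

-- FRACTRAN programs: lists of pairs (p , q) standing for p/q
FractranProg : Set
FractranProg = List (ℕ × ℕ)

data _∶_≻_ : FractranProg → ℕ → ℕ → Set where
  step-here : ∀ {p q Q x y} → q * y ≡ p * x → ((p , q) ∷ Q) ∶ x ≻ y
  step-next : ∀ {p q Q x y} → ¬ (q ∣ p * x) → Q ∶ x ≻ y → ((p , q) ∷ Q) ∶ x ≻ y

-- Diophantine logic formulas (De Bruijn indices)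
data DioForm : Set where
  _≐c_   : ℕ → ℕ → DioForm
  _≐v_   : ℕ → ℕ → DioForm
  _≐_+̇_  : ℕ → ℕ → ℕ → DioForm
  _≐_×̇_  : ℕ → ℕ → ℕ → DioForm
  _∧̇_    : DioForm → DioForm → DioForm
  _∨̇_    : DioForm → DioForm → DioForm
  ∃̇      : DioForm → DioForm

Valuation : Set
Valuation = ℕ → ℕ

_·_ : ℕ → Valuation → Valuation
(n · ν) zero    = n
(n · ν) (suc i) = ν i

↑ : Valuation → Valuation
↑ ν i = ν (suc i)

⟦_⟧ : DioForm → Valuation → Set
⟦ i ≐c n ⟧ ν = ν i ≡ n
⟦ i ≐v j ⟧ ν = ν i ≡ ν j
⟦ i ≐ j +̇ k ⟧ ν = ν i ≡ ν j + ν k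
⟦ i ≐ j ×̇ k ⟧ ν = ν i ≡ ν j * ν k
⟦ A ∧̇ B ⟧ ν = ⟦ A ⟧ ν × ⟦ B ⟧ ν
⟦ A ∨̇ B ⟧ ν = ⟦ A ⟧ ν ⊎ ⟦ B ⟧ ν
⟦ ∃̇ A ⟧ ν = Σ ℕ λ n → ⟦ A ⟧ (n · ν)

IsDioWitnessRel : (Valuation → Set) → DioForm → Set
IsDioWitnessRel S A = ∀ ν → ⟦ A ⟧ ν ⇔ S ν

DioRel : (Valuation → Set) → Set
DioRel S = Σ DioForm (IsDioWitnessRel S)

DioFun : (Valuation → ℕ) → Set
DioFun f = DioRel (λ ν → ν 0 ≡ f (↑ ν))

-- A program Q has no step from x exactly when no fraction p/q of Q applies, i.e. q ∤ p·x for
-- every p/q in Q. Non-divisibility is Diophantine (a positive remainder below q exists), and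
-- Diophantine relations are closed under conjunction, finite conjunction and projection, so
-- "∃ x. x = f ν ∧ Q is stuck at x" has a witness built from the one for f.
module Submission where

open import Defs
open import Data.Nat using (ℕ; zero; suc; _+_; _*_; _∸_; _≤_; _<_; NonZero)
open import Data.Nat.Properties using (+-comm; *-comm; m≤m+n; ≤-trans; <-irrefl; ≤-pred; m+[n∸m]≡n)
open import Data.Nat.Divisibility using (_∣_; _∤_; divides; 0∣⇒≡0; ∣m+n∣m⇒∣n; n∣m*n; ∣⇒≤; m%n≡0⇒n∣m)
open import Data.Nat.DivMod using (_/_; _%_; m≡m%n+[m/n]*n; m%n<n)
open import Data.Product using (_×_; _,_; ∃-syntax)
open import Data.List using (List; []; _∷_)
open import Data.List.Relation.Unary.All using (All; []; _∷_)
open import Data.Empty using (⊥-elim)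
open import Relation.Nullary using (¬_)
open import Relation.Binary.PropositionalEquality using (_≡_; refl; sym; trans; cong; subst; module ≡-Reasoning)
open import Function.Bundles using (_⇔_; mk⇔; Equivalence)
open import Function.Construct.Composition using (_⇔-∘_)
open import Function.Construct.Symmetry using (⇔-sym)

open Equivalence

dio-⇔ : ∀ {R S : Valuation → Set} → (∀ ν → R ν ⇔ S ν) → DioRel R → DioRel S
dio-⇔ R⇔S (A , wA) = A , λ ν → R⇔S ν ⇔-∘ wA ν

dio-∧ : ∀ {R S : Valuation → Set} → DioRel R → DioRel S → DioRel (λ ν → R ν × S ν)
dio-∧ (A , wA) (B , wB) = A ∧̇ B , λ ν →
  mk⇔ (λ (a , b) → to (wA ν) a , to (wB ν) b) (λ (r , s) → from (wA ν) r , from (wB ν) s)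

dio-∃ : ∀ {R : Valuation → Set} → DioRel R → DioRel (λ ν → ∃[ n ] R (n · ν))
dio-∃ (A , wA) = ∃̇ A , λ ν →
  mk⇔ (λ (n , a) → n , to (wA (n · ν)) a) (λ (n , r) → n , from (wA (n · ν)) r)

dio-All : ∀ {I : Set} (R : I → Valuation → Set) (is : List I) →
          (∀ i → DioRel (R i)) → DioRel (λ ν → All (λ i → R i ν) is)
dio-All R [] dioR = 0 ≐v 0 , λ ν → mk⇔ (λ _ → []) (λ _ → refl)
dio-All R (i ∷ is) dioR =
  dio-⇔ (λ ν → mk⇔ (λ (r , rs) → r ∷ rs) (λ { (r ∷ rs) → r , rs }))
        (dio-∧ (dioR i) (dio-All R is dioR))

∃≡×⇔ : ∀ {P : ℕ → Set} {k : ℕ} → (∃[ n ] (n ≡ k × P n)) ⇔ P k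
∃≡×⇔ = mk⇔ (λ { (n , refl , p) → p }) (λ p → _ , refl , p)

0∤⇔positive : ∀ {m} → 0 ∤ m ⇔ (∃[ r ] m ≡ r + 1)
0∤⇔positive = mk⇔ to′ from′
  where
  to′ : ∀ {m} → 0 ∤ m → ∃[ r ] m ≡ r + 1
  to′ {zero}  0∤0 = ⊥-elim (0∤0 (divides 0 refl))
  to′ {suc r} _   = r , +-comm 1 r
  from′ : ∀ {m} → ∃[ r ] m ≡ r + 1 → 0 ∤ m
  from′ (r , refl) 0∣r+1 with trans (+-comm 1 r) (0∣⇒≡0 0∣r+1)
  ... | ()

suc∤⇔positiveRemainder : ∀ {q m} →
  suc q ∤ m ⇔ (∃[ a ] ∃[ r ] ∃[ d ] (m ≡ a * suc q + (r + 1) × q ≡ r + 1 + d))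
suc∤⇔positiveRemainder {q} {m} = mk⇔ to′ from′
  where
  to′ : suc q ∤ m → ∃[ a ] ∃[ r ] ∃[ d ] (m ≡ a * suc q + (r + 1) × q ≡ r + 1 + d)
  to′ ∤m with m % suc q in m%n≡
  ... | zero  = ⊥-elim (∤m (m%n≡0⇒n∣m m (suc q) m%n≡))
  ... | suc r = m / suc q , r , q ∸ (r + 1) , m≡ , sym (m+[n∸m]≡n r+1≤q)
    where
    r+1≤q : r + 1 ≤ q
    r+1≤q = subst (_≤ q) (+-comm 1 r) (≤-pred (subst (_< suc q) m%n≡ (m%n<n m (suc q))))
    m≡ : m ≡ m / suc q * suc q + (r + 1)
    m≡ = begin
      m                             ≡⟨ m≡m%n+[m/n]*n m (suc q) ⟩
      m % suc q + m / suc q * suc q ≡⟨ cong (_+ m / suc q * suc q) (trans m%n≡ (+-comm 1 r)) ⟩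
      r + 1 + m / suc q * suc q     ≡⟨ +-comm (r + 1) (m / suc q * suc q) ⟩
      m / suc q * suc q + (r + 1)   ∎
      where open ≡-Reasoning
  -- the remainder r + 1 would be a positive multiple of suc q, yet it is at most q
  from′ : ∃[ a ] ∃[ r ] ∃[ d ] (m ≡ a * suc q + (r + 1) × q ≡ r + 1 + d) → suc q ∤ m
  from′ (a , r , d , refl , q≡) ∣m = <-irrefl refl (≤-trans (∣⇒≤ {{r+1≢0}} ∣r+1) r+1≤q)
    where
    ∣r+1 : suc q ∣ r + 1
    ∣r+1 = ∣m+n∣m⇒∣n ∣m (n∣m*n a)
    r+1≢0 : NonZero (r + 1)
    r+1≢0 = subst NonZero (+-comm 1 r) _
    r+1≤q : r + 1 ≤ q
    r+1≤q = subst (r + 1 ≤_) (sym q≡) (m≤m+n (r + 1) d)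

dio-∤ : ∀ q → DioRel (λ ν → q ∤ ν 0)
dio-∤ zero = dio-⇔ (λ _ → ⇔-sym 0∤⇔positive)
  (∃̇ (∃̇ ((0 ≐c 1) ∧̇ (2 ≐ 1 +̇ 0))) , λ ν → mk⇔
    (λ { (r , .1 , refl , m≡) → r , m≡ })
    (λ (r , m≡) → r , 1 , refl , m≡))
-- variables a r d c one t s q′, with c = suc q, t = a·c, s = r + 1, m = t + s, q′ = s + d = q
dio-∤ (suc q) = dio-⇔ (λ _ → ⇔-sym suc∤⇔positiveRemainder)
  (∃̇ (∃̇ (∃̇ (∃̇ (∃̇ (∃̇ (∃̇ (∃̇
    ((4 ≐c suc q) ∧̇ ((3 ≐c 1) ∧̇ ((2 ≐ 7 ×̇ 4) ∧̇ ((1 ≐ 6 +̇ 3) ∧̇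
     ((8 ≐ 2 +̇ 1) ∧̇ ((0 ≐ 1 +̇ 5) ∧̇ (0 ≐c q)))))))))))))) , λ ν → mk⇔
    (λ { (a , r , d , ._ , ._ , ._ , ._ , ._ , refl , refl , refl , refl , m≡ , q≡ , refl) →
         a , r , d , m≡ , q≡ })
    (λ (a , r , d , m≡ , q≡) →
         a , r , d , suc q , 1 , a * suc q , r + 1 , q ,
         refl , refl , refl , refl , m≡ , q≡ , refl))

dio-≡* : ∀ p → DioRel (λ ν → ν 0 ≡ p * ν 1)
dio-≡* p = ∃̇ ((0 ≐c p) ∧̇ (1 ≐ 0 ×̇ 2)) , λ ν →
  mk⇔ (λ { (._ , refl , eq) → eq }) (λ eq → p , refl , eq)

dio-∤* : ∀ p q → DioRel (λ ν → q ∤ p * ν 0)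
dio-∤* p q = dio-⇔ (λ _ → ∃≡×⇔) (dio-∃ (dio-∧ (dio-≡* p) (dio-∤ q)))

Inapplicable : ℕ → ℕ × ℕ → Set
Inapplicable x (p , q) = q ∤ p * x

Stuck : FractranProg → ℕ → Set
Stuck Q x = All (Inapplicable x) Q

noStep⇔Stuck : ∀ Q x → (∀ y → ¬ (Q ∶ x ≻ y)) ⇔ Stuck Q x
noStep⇔Stuck [] x = mk⇔ (λ _ → []) (λ _ y ())
noStep⇔Stuck ((p , q) ∷ Q) x = mk⇔ to′ from′
  where
  to′ : (∀ y → ¬ (((p , q) ∷ Q) ∶ x ≻ y)) → Stuck ((p , q) ∷ Q) x
  to′ noStep = ∤px ∷ to (noStep⇔Stuck Q x) (λ y s → noStep y (step-next ∤px s))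
    where
    ∤px : q ∤ p * x
    ∤px (divides y eq) = noStep y (step-here (trans (*-comm q y) (sym eq)))
  from′ : Stuck ((p , q) ∷ Q) x → ∀ y → ¬ (((p , q) ∷ Q) ∶ x ≻ y)
  from′ (∤px ∷ _) y (step-here eq) = ∤px (divides y (trans (sym eq) (*-comm q y)))
  from′ (_ ∷ stuck) y (step-next _ s) = from (noStep⇔Stuck Q x) stuck y s

dio-Stuck : ∀ Q → DioRel (λ ν → Stuck Q (ν 0))
dio-Stuck Q = dio-All (λ pq ν → Inapplicable (ν 0) pq) Q (λ { (p , q) → dio-∤* p q })

lemma7p2 : (Q : FractranProg) (f : Valuation → ℕ) →
           DioFun f → DioRel (λ ν → (y : ℕ) → ¬ (Q ∶ f ν ≻ y))
lemma7p2 Q f dioF =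
  dio-⇔ (λ ν → ⇔-sym (noStep⇔Stuck Q (f ν)) ⇔-∘ ∃≡×⇔) (dio-∃ (dio-∧ dioF (dio-Stuck Q)))
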